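{- Let $G$ be a graph constructed, together with a coloring of its vertices, by the following procedure: (1) Construct an odd cycle and color its vertices blue. (2) Either perform step (3), or perform step (4), or stop. (3) Choose any existing vertex $u$, add two new vertices $u_1,u_2$ and edges $uu_1, u_1u_2$; color $u_1$ red and $u_2$ black; go to (2). (4) If there is no red vertex go to (2); otherwise choose a red vertex $u$, add a new vertex $u_1$ and the edge $uu_1$, color $u_1$ black; go to (2). Then every maximum matching of $G$ covers all the red vertices of $G$.
   Context: All graphs are finite and simple. A maximum matching is a matching of largest possible size; it covers a vertex if the vertex is an endpoint of one of its edges. -}

module Defs where

open import Data.Nat using (ℕ; zero; suc; _+_; _*_; _<_)
open import Data.Nat.DivMod using (_%_)
open import Data.Product using (_×_; _,_; Σ; ∃-syntax)
open import Data.Sum using (_⊎_)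
open import Data.List using (List; []; _∷_; length; concatMap; upTo; map; _++_)
open import Data.List.Membership.Propositional using (_∈_)
open import Data.List.Relation.Unary.Unique.Propositional using (Unique)
open import Relation.Binary.PropositionalEquality using (_≡_)
open import Relation.Nullary using (¬_)

data Colour : Set where
  blue red black : Colour

-- A finite simple graph with vertex set {0, …, n-1}, given by an (undirected)
-- edge list; an edge (a , b) joins a and b.  Together with a vertex colouring.
record CGraph : Set where
  constructor mkCGraph
  field
    size   : ℕ
    edges  : List (ℕ × ℕ)
    colour : ℕ → Colour
open CGraph public

Adjacent : CGraph → ℕ → ℕ → Set
Adjacent G u v = (u , v) ∈ edges G ⊎ (v , u) ∈ edges G

Vertex : CGraph → ℕ → Set
Vertex G v = v < size G

oddCycle : ℕ → CGraph
oddCycle m = mkCGraph k (map (λ i → (i , (suc i) % k)) (upTo k)) (λ _ → blue)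
  where
  k : ℕ
  k = suc (suc (suc (2 * m)))

setColour : (ℕ → Colour) → ℕ → Colour → ℕ → Colour
setColour c v x w with Data.Nat._≟_ w v
... | Relation.Nullary.yes _ = x
... | Relation.Nullary.no  _ = c w

-- Step (3): pick existing u, add u1 = n (red), u2 = n+1 (black), edges u u1, u1 u2.
step3 : (G : CGraph) → ℕ → CGraph
step3 G u = mkCGraph (suc (suc n)) ((u , n) ∷ (n , suc n) ∷ edges G)
                     (setColour (setColour (colour G) n red) (suc n) black)
  where
  n : ℕ
  n = size G

-- Step (4): pick a red vertex u, add u1 = n (black) and edge u u1.
step4 : (G : CGraph) → ℕ → CGraph
step4 G u = mkCGraph (suc n) ((u , n) ∷ edges G) (setColour (colour G) n black)
  where
  n : ℕ
  n = size G

data Constructible : CGraph → Set where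
  cycle : (m : ℕ) → Constructible (oddCycle m)
  add3  : ∀ {G} → Constructible G → (u : ℕ) → Vertex G u →
          Constructible (step3 G u)
  add4  : ∀ {G} → Constructible G → (u : ℕ) → Vertex G u → colour G u ≡ red →
          Constructible (step4 G u)

endpoints : List (ℕ × ℕ) → List ℕ
endpoints = concatMap (λ { (a , b) → a ∷ b ∷ [] })

-- A matching: a list of edges of G no two of which share an endpoint
-- (encoded as: the list of all endpoints has no repetition).
record IsMatching (G : CGraph) (M : List (ℕ × ℕ)) : Set where
  field
    inGraph  : ∀ {a b} → (a , b) ∈ M → Adjacent G a b
    disjoint : Unique (endpoints M)

IsMaximumMatching : CGraph → List (ℕ × ℕ) → Set
IsMaximumMatching G M =
  IsMatching G M × (∀ M′ → IsMatching G M′ → length M′ Data.Nat.≤ length M)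

Covers : List (ℕ × ℕ) → ℕ → Set
Covers M v = v ∈ endpoints M

-- Every constructible graph G has an explicit matching of some size ν: a perfect
-- matching of the odd cycle minus one vertex, plus the edge u₁u₂ of every step (3).
-- By induction along the construction, every matching M of G satisfies |M| + e ≤ ν,
-- where e is the number of red vertices left exposed by M.  On the cycle there are
-- no red vertices and |M| ≤ ν by counting.  In a step (3), either the red u₁ is
-- exposed, or deleting the one edge at u₁ costs one edge of M.  In a step (4), u₁
-- can only be matched to the red u, and deleting that edge exposes u instead.
-- Hence a maximum matching, of size at least ν, leaves no red vertex exposed.
module Submission where

open import Defs
open import Level using (Level)
open import Function using (_∘_; _$_)
open import Data.Nat using (ℕ; zero; suc; _+_; _<_; _≤_; z≤n; s≤s; _≟_)
open import Data.Nat.Properties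
open import Data.Nat.DivMod using (_%_; m%n<n; m<n⇒m%n≡m)
open import Data.List using (List; []; _∷_; length; filter)
open import Data.List.Properties using (filter-all)
open import Data.List.Membership.Propositional using (_∈_; find; lose)
open import Data.List.Membership.Propositional.Properties using (∈-upTo⁺; ∈-upTo⁻; ∈-map⁺; ∈-map⁻; ∈-filter⁻)
open import Data.List.Membership.DecPropositional _≟_ using (_∈?_)
open import Data.List.Relation.Unary.Any as Any using (Any; here; there)
open import Data.List.Relation.Unary.Any.Properties as Anyₚ using ()
open import Data.List.Relation.Unary.All as All using (All; []; _∷_)
open import Data.List.Relation.Unary.All.Properties using (¬Any⇒All¬; anti-mono)
open import Data.List.Relation.Unary.AllPairs as AllPairs using (AllPairs; []; _∷_)
open import Data.List.Relation.Unary.Unique.Propositional using (Unique)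
open import Data.List.Relation.Unary.Unique.Propositional.Properties as Uniqueₚ using ()
open import Data.Product using (_×_; _,_; proj₁; proj₂)
open import Data.Sum using (_⊎_; inj₁; inj₂; [_,_]′)
open import Data.Empty using (⊥-elim)
open import Relation.Nullary using (¬_; Dec; yes; no; ¬?; contradiction)
open import Relation.Nullary.Decidable using (_⊎-dec_)
open import Relation.Unary using (Pred; Decidable)
open import Relation.Binary.PropositionalEquality
  using (_≡_; _≢_; refl; sym; trans; cong; cong₂; subst; subst₂; ≢-sym; module ≡-Reasoning)

private
  variable
    a p : Level
    A : Set a

AtMostOne : Pred A p → Pred (List A) _
AtMostOne P = AllPairs (λ x y → P x → ¬ P y)

atMostOne⇒≡ : ∀ {P : Pred A p} {xs x y} → AtMostOne P xs →
              x ∈ xs → y ∈ xs → P x → P y → x ≡ y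
atMostOne⇒≡ _            (here refl) (here refl) _  _  = refl
atMostOne⇒≡ (x-only ∷ _) (here refl) (there y∈) px py = ⊥-elim (All.lookup x-only y∈ px py)
atMostOne⇒≡ (y-only ∷ _) (there x∈) (here refl) px py = ⊥-elim (All.lookup y-only x∈ py px)
atMostOne⇒≡ (_ ∷ rest)   (there x∈) (there y∈) px py = atMostOne⇒≡ rest x∈ y∈ px py

unique⇒atMostOne : ∀ {x : A} {xs} → Unique xs → AtMostOne (x ≡_) xs
unique⇒atMostOne = AllPairs.map λ { y≢z refl → y≢z }

module _ {P : Pred A p} (P? : Decidable P) where

  length-filter-¬-any : ∀ {xs} → AtMostOne P xs → Any P xs →
                        length xs ≡ suc (length (filter (¬? ∘ P?) xs))
  length-filter-¬-any {x ∷ xs} (x-only ∷ rest) any with P? x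
  ... | yes px rewrite filter-all (¬? ∘ P?) (All.map (_$ px) x-only) = refl
  ... | no ¬px = cong suc (length-filter-¬-any rest (Any.tail ¬px any))

  length-filter-¬ : ∀ {xs} → AtMostOne P xs → length xs ≤ suc (length (filter (¬? ∘ P?) xs))
  length-filter-¬ {xs} at-most-one with Any.any? P? xs
  ... | yes any = ≤-reflexive (length-filter-¬-any at-most-one any)
  ... | no ¬any = ≤-trans (≤-reflexive (cong length (sym (filter-all (¬? ∘ P?) (¬Any⇒All¬ xs ¬any)))))
                          (n≤1+n _)

unique⇒length≤ : ∀ k {xs} → Unique xs → All (_< k) xs → length xs ≤ k
unique⇒length≤ zero    {[]}    _ _           = z≤n
unique⇒length≤ zero    {_ ∷ _} _ (() ∷ _)
unique⇒length≤ (suc k) {xs}    distinct xs<k =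
  ≤-trans (length-filter-¬ (k ≟_) (unique⇒atMostOne distinct))
          (s≤s (unique⇒length≤ k (Uniqueₚ.filter⁺ (¬? ∘ (k ≟_)) distinct) rest<k))
  where
  rest<k : All (_< k) (filter (¬? ∘ (k ≟_)) xs)
  rest<k = All.tabulate λ w∈ → let w∈xs , k≢w = ∈-filter⁻ (¬? ∘ (k ≟_)) w∈
                               in ≤∧≢⇒< (≤-pred (All.lookup xs<k w∈xs)) (≢-sym k≢w)

fresh-pair-bounded : ∀ {n E} → All (_< n) E → All (_< suc (suc n)) (n ∷ suc n ∷ E)
fresh-pair-bounded {n} E<n = m<n⇒m<1+n (n<1+n n) ∷ n<1+n (suc n) ∷ All.map (m<n⇒m<1+n ∘ m<n⇒m<1+n) E<n

fresh-pair-unique : ∀ {n E} → All (_< n) E → Unique E → Unique (n ∷ suc n ∷ E)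
fresh-pair-unique {n} E<n distinct =
  (<⇒≢ (n<1+n n) ∷ All.map >⇒≢ E<n) ∷ All.map (>⇒≢ ∘ m<n⇒m<1+n) E<n ∷ distinct

m+m≤1+n+n⇒m≤n : ∀ m n → m + m ≤ suc (n + n) → m ≤ n
m+m≤1+n+n⇒m≤n zero    n       _       = z≤n
m+m≤1+n+n⇒m≤n (suc m) zero    (s≤s p) = contradiction (subst (_≤ 0) (+-suc m m) p) λ ()
m+m≤1+n+n⇒m≤n (suc m) (suc n) (s≤s p) =
  s≤s (m+m≤1+n+n⇒m≤n m n (≤-pred (subst₂ _≤_ (+-suc m m) (cong suc (+-suc n n)) p)))

Touches : ℕ → ℕ × ℕ → Set
Touches x (a , b) = x ≡ a ⊎ x ≡ b

touches? : ∀ x e → Dec (Touches x e)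
touches? x (a , b) = (x ≟ a) ⊎-dec (x ≟ b)

touches-swap : ∀ {x a b} → Touches x (a , b) → Touches x (b , a)
touches-swap (inj₁ x≡a) = inj₂ x≡a
touches-swap (inj₂ x≡b) = inj₁ x≡b

covers⇒any : ∀ {x} M → Covers M x → Any (Touches x) M
covers⇒any (_ ∷ _) (here x≡a)          = here (inj₁ x≡a)
covers⇒any (_ ∷ _) (there (here x≡b))  = here (inj₂ x≡b)
covers⇒any (_ ∷ M) (there (there x∈)) = there (covers⇒any M x∈)

any⇒covers : ∀ {x} M → Any (Touches x) M → Covers M x
any⇒covers (_ ∷ _) (here (inj₁ x≡a)) = here x≡a
any⇒covers (_ ∷ _) (here (inj₂ x≡b)) = there (here x≡b)
any⇒covers (_ ∷ M) (there any)       = there (there (any⇒covers M any))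

covers-filter⁻ : ∀ {P : Pred (ℕ × ℕ) p} (P? : Decidable P) {x} M → Covers (filter P? M) x → Covers M x
covers-filter⁻ P? M = any⇒covers M ∘ Anyₚ.filter⁻ P? ∘ covers⇒any (filter P? M)

Disjoint : List (ℕ × ℕ) → Set
Disjoint M = Unique (endpoints M)

filter-disjoint : ∀ {P : Pred (ℕ × ℕ) p} (P? : Decidable P) M → Disjoint M → Disjoint (filter P? M)
filter-disjoint P? []            _ = []
filter-disjoint P? (e ∷ M) ((a≢b ∷ a∉) ∷ b∉ ∷ distinct) with P? e
... | yes _ = (a≢b ∷ anti-mono kept a∉) ∷ anti-mono kept b∉ ∷ filter-disjoint P? M distinct
  where
  kept : ∀ {w} → Covers (filter P? M) w → Covers M w
  kept = covers-filter⁻ P? M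
... | no _ = filter-disjoint P? M distinct

disjoint⇒atMostOne : ∀ {x} M → Disjoint M → AtMostOne (Touches x) M
disjoint⇒atMostOne      []            _ = []
disjoint⇒atMostOne {x} ((a , b) ∷ M) ((_ ∷ a∉) ∷ b∉ ∷ distinct) =
  All.tabulate only ∷ disjoint⇒atMostOne M distinct
  where
  only : ∀ {e} → e ∈ M → Touches x (a , b) → ¬ Touches x e
  only e∈ (inj₁ refl) x-e = All.lookup a∉ (any⇒covers M (lose e∈ x-e)) refl
  only e∈ (inj₂ refl) x-e = All.lookup b∉ (any⇒covers M (lose e∈ x-e)) refl

_∖_ : List (ℕ × ℕ) → ℕ → List (ℕ × ℕ)
M ∖ x = filter (¬? ∘ touches? x) M

∈-∖⁻ : ∀ {x e} M → e ∈ M ∖ x → e ∈ M × ¬ Touches x e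
∈-∖⁻ {x} M = ∈-filter⁻ (¬? ∘ touches? x) {xs = M}

∖-covers⁻ : ∀ {x w} M → Covers (M ∖ x) w → Covers M w
∖-covers⁻ {x} M = covers-filter⁻ (¬? ∘ touches? x) M

∖-uncovered : ∀ {x} M → ¬ Covers M x → M ∖ x ≡ M
∖-uncovered M uncovered = filter-all (¬? ∘ touches? _) (¬Any⇒All¬ M (uncovered ∘ any⇒covers M))

length-∖-covered : ∀ {x} M → Disjoint M → Covers M x → length M ≡ suc (length (M ∖ x))
length-∖-covered M distinct covered =
  length-filter-¬-any (touches? _) (disjoint⇒atMostOne M distinct) (covers⇒any M covered)

length-∖ : ∀ {x} M → Disjoint M → length M ≤ suc (length (M ∖ x))
length-∖ M distinct = length-filter-¬ (touches? _) (disjoint⇒atMostOne M distinct)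

∖-partner-exposed : ∀ {x u e} M → Disjoint M → e ∈ M → Touches x e → Touches u e → ¬ Covers (M ∖ x) u
∖-partner-exposed {x} {u} M distinct e∈ x-e u-e covered with find (covers⇒any (M ∖ x) covered)
... | f , f∈ , u-f with ∈-∖⁻ M f∈
... | f∈M , ¬x-f = ¬x-f (subst (Touches x) (atMostOne⇒≡ (disjoint⇒atMostOne M distinct) e∈ f∈M u-e u-f) x-e)

IsMatching-∖ : ∀ {G G′ x M} → (∀ {a b} → (a , b) ∈ edges G′ → ¬ Touches x (a , b) → (a , b) ∈ edges G) →
               IsMatching G′ M → IsMatching G (M ∖ x)
IsMatching-∖ {G} {G′} {x} {M} old-edge matching = record
  { inGraph  = λ e∈ → let e∈M , ¬x-e = ∈-∖⁻ M e∈ in restrict (IsMatching.inGraph matching e∈M) ¬x-e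
  ; disjoint = filter-disjoint (¬? ∘ touches? x) M (IsMatching.disjoint matching)
  }
  where
  restrict : ∀ {a b} → Adjacent G′ a b → ¬ Touches x (a , b) → Adjacent G a b
  restrict (inj₁ e) ¬x-e = inj₁ (old-edge e ¬x-e)
  restrict (inj₂ e) ¬x-e = inj₂ (old-edge e (¬x-e ∘ touches-swap))

EdgesBounded : CGraph → Set
EdgesBounded G = ∀ {a b} → (a , b) ∈ edges G → Vertex G a × Vertex G b

covered⇒vertex : ∀ {G M w} → EdgesBounded G → IsMatching G M → Covers M w → Vertex G w
covered⇒vertex {M = M} bounded matching covered with find (covers⇒any M covered)
... | (a , b) , e∈ , w-e with IsMatching.inGraph matching e∈ | w-e
... | inj₁ e | inj₁ refl = proj₁ (bounded e)
... | inj₁ e | inj₂ refl = proj₂ (bounded e)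
... | inj₂ e | inj₁ refl = proj₂ (bounded e)
... | inj₂ e | inj₂ refl = proj₁ (bounded e)

new-vertex-untouched : ∀ {G a b} → EdgesBounded G → (a , b) ∈ edges G → ¬ Touches (size G) (a , b)
new-vertex-untouched bounded e (inj₁ refl) = <-irrefl refl (proj₁ (bounded e))
new-vertex-untouched bounded e (inj₂ refl) = <-irrefl refl (proj₂ (bounded e))

setColour-same : ∀ c v x → setColour c v x v ≡ x
setColour-same c v x with v ≟ v
... | yes _   = refl
... | no v≢v = contradiction refl v≢v

setColour-other : ∀ c v x {w} → w ≢ v → setColour c v x w ≡ c w
setColour-other c v x {w} w≢v with w ≟ v
... | yes w≡v = contradiction w≡v w≢v
... | no _    = refl

step3-old-edge : ∀ {G u a b} → (a , b) ∈ edges (step3 G u) → ¬ Touches (size G) (a , b) → (a , b) ∈ edges G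
step3-old-edge (here refl)         ¬n-e = contradiction (inj₂ refl) ¬n-e
step3-old-edge (there (here refl)) ¬n-e = contradiction (inj₁ refl) ¬n-e
step3-old-edge (there (there e))   _    = e

step4-old-edge : ∀ {G u a b} → (a , b) ∈ edges (step4 G u) → ¬ Touches (size G) (a , b) → (a , b) ∈ edges G
step4-old-edge (here refl) ¬n-e = contradiction (inj₂ refl) ¬n-e
step4-old-edge (there e)   _    = e

step4-new-edge : ∀ {G u a b} → EdgesBounded G → Adjacent (step4 G u) a b →
                 Touches (size G) (a , b) → Touches u (a , b)
step4-new-edge _ (inj₁ (here refl)) _ = inj₁ refl
step4-new-edge _ (inj₂ (here refl)) _ = inj₂ refl
step4-new-edge {G} bounded (inj₁ (there e)) n-e = contradiction n-e (new-vertex-untouched {G} bounded e)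
step4-new-edge {G} bounded (inj₂ (there e)) n-e =
  contradiction (touches-swap n-e) (new-vertex-untouched {G} bounded e)

ExposedRed : CGraph → List (ℕ × ℕ) → ℕ → Set
ExposedRed G M v = Vertex G v × colour G v ≡ red × ¬ Covers M v

step3-exposedRed : ∀ {G u M v} → size G ≢ v → ExposedRed (step3 G u) M v → ExposedRed G (M ∖ size G) v
step3-exposedRed {G} {u} {M} {v} n≢v (v<n+2 , v-red , uncovered) =
  v<n , trans (sym colour-old) v-red , uncovered ∘ ∖-covers⁻ M
  where
  n = size G
  v≢n+1 : v ≢ suc n
  v≢n+1 refl with () ← trans (sym (setColour-same (setColour (colour G) n red) (suc n) black)) v-red
  colour-old : colour (step3 G u) v ≡ colour G v
  colour-old = trans (setColour-other _ (suc n) black v≢n+1) (setColour-other _ n red (≢-sym n≢v))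
  v<n : v < n
  v<n = ≤∧≢⇒< (≤-pred (≤∧≢⇒< (≤-pred v<n+2) v≢n+1)) (≢-sym n≢v)

step4-exposedRed : ∀ {G u M v} → ExposedRed (step4 G u) M v → ExposedRed G (M ∖ size G) v
step4-exposedRed {G} {u} {M} {v} (v<n+1 , v-red , uncovered) =
  ≤∧≢⇒< (≤-pred v<n+1) v≢n , trans (sym colour-old) v-red , uncovered ∘ ∖-covers⁻ M
  where
  n = size G
  v≢n : v ≢ n
  v≢n refl with () ← trans (sym (setColour-same (colour G) n black)) v-red
  colour-old : colour (step4 G u) v ≡ colour G v
  colour-old = setColour-other _ n black v≢n

MatchingBound : CGraph → ℕ → Set
MatchingBound G ν = ∀ {M L} → IsMatching G M → Unique L → All (ExposedRed G M) L → length M + length L ≤ ν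

oddCycle-size : ∀ m → size (oddCycle m) ≡ suc (suc m + suc m)
oddCycle-size m = cong (suc ∘ suc) (trans (cong (suc ∘ (m +_)) (+-identityʳ m)) (sym (+-suc m m)))

oddCycle-edgesBounded : ∀ m → EdgesBounded (oddCycle m)
oddCycle-edgesBounded m e with ∈-map⁻ (λ i → (i , suc i % size (oddCycle m))) e
... | i , i∈ , refl = ∈-upTo⁻ i∈ , m%n<n (suc i) (size (oddCycle m))

oddCycle-consecutive-edge : ∀ m {i} → suc i < size (oddCycle m) → (i , suc i) ∈ edges (oddCycle m)
oddCycle-consecutive-edge m {i} i+1<k =
  subst (λ j → (i , j) ∈ edges (oddCycle m)) (m<n⇒m%n≡m i+1<k)
        (∈-map⁺ (λ j → (j , suc j % size (oddCycle m))) (∈-upTo⁺ (<-trans (n<1+n i) i+1<k)))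

pathMatching : ℕ → List (ℕ × ℕ)
pathMatching zero    = []
pathMatching (suc j) = (j + j , suc (j + j)) ∷ pathMatching j

length-pathMatching : ∀ j → length (pathMatching j) ≡ j
length-pathMatching zero    = refl
length-pathMatching (suc j) = cong suc (length-pathMatching j)

pathMatching-bounded : ∀ j → All (_< j + j) (endpoints (pathMatching j))
pathMatching-bounded zero    = []
pathMatching-bounded (suc j) rewrite +-suc j j = fresh-pair-bounded (pathMatching-bounded j)

pathMatching-disjoint : ∀ j → Disjoint (pathMatching j)
pathMatching-disjoint zero    = []
pathMatching-disjoint (suc j) = fresh-pair-unique (pathMatching-bounded j) (pathMatching-disjoint j)

pathMatching-in-oddCycle : ∀ m j {a b} → j + j ≤ size (oddCycle m) →
                           (a , b) ∈ pathMatching j → (a , b) ∈ edges (oddCycle m)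
pathMatching-in-oddCycle m (suc j) 2j+2≤k = λ
  { (here refl) → oddCycle-consecutive-edge m 2j+1<k
  ; (there e)   → pathMatching-in-oddCycle m j (m+n≤o⇒n≤o 2 2j+1<k) e
  }
  where
  2j+1<k : suc (j + j) < size (oddCycle m)
  2j+1<k = subst (_≤ size (oddCycle m)) (cong suc (+-suc j j)) 2j+2≤k

length-endpoints : ∀ M → length (endpoints M) ≡ length M + length M
length-endpoints []      = refl
length-endpoints (_ ∷ M) = cong suc (trans (cong suc (length-endpoints M)) (sym (+-suc _ _)))

matching-size : ∀ {G M} → EdgesBounded G → IsMatching G M → length M + length M ≤ size G
matching-size {G} {M} bounded matching =
  subst (_≤ size G) (length-endpoints M)
        (unique⇒length≤ (size G) (IsMatching.disjoint matching) (All.tabulate (covered⇒vertex bounded matching)))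

oddCycle-bound : ∀ m → MatchingBound (oddCycle m) (suc m)
oddCycle-bound m {M} {[]} matching _ [] =
  subst (_≤ suc m) (sym (+-identityʳ (length M)))
        (m+m≤1+n+n⇒m≤n (length M) (suc m)
          (subst (length M + length M ≤_) (oddCycle-size m) (matching-size (oddCycle-edgesBounded m) matching)))
oddCycle-bound m {L = _ ∷ _} _ _ ((_ , () , _) ∷ _)

step3-restrict : ∀ {G u M} → IsMatching (step3 G u) M → IsMatching G (M ∖ size G)
step3-restrict {G} {u} = IsMatching-∖ {G} {step3 G u} (step3-old-edge {G} {u})

step4-restrict : ∀ {G u M} → IsMatching (step4 G u) M → IsMatching G (M ∖ size G)
step4-restrict {G} {u} = IsMatching-∖ {G} {step4 G u} (step4-old-edge {G} {u})

step3-bound : ∀ {G u ν} → MatchingBound G ν → MatchingBound (step3 G u) (suc ν)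
step3-bound {G} {u} bound {M} {L} matching distinct exposed =
  ≤-trans count (s≤s (bound (step3-restrict {G} {u} matching) (Uniqueₚ.filter⁺ (¬? ∘ (n ≟_)) distinct)
                            exposed′))
  where
  n : ℕ
  n = size G
  L′ : List ℕ
  L′ = filter (¬? ∘ (n ≟_)) L
  exposed′ : All (ExposedRed G (M ∖ n)) L′
  exposed′ = All.tabulate λ v∈ → let v∈L , n≢v = ∈-filter⁻ (¬? ∘ (n ≟_)) {xs = L} v∈
                                 in step3-exposedRed {G} {u} {M} n≢v (All.lookup exposed v∈L)
  count : length M + length L ≤ suc (length (M ∖ n) + length L′)
  count with n ∈? L
  ... | yes n∈L = ≤-reflexive (begin
    length M + length L             ≡⟨ cong₂ _+_ (cong length (sym (∖-uncovered M n-exposed)))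
                                                 (length-filter-¬-any (n ≟_) (unique⇒atMostOne distinct) n∈L) ⟩
    length (M ∖ n) + suc (length L′) ≡⟨ +-suc _ _ ⟩
    suc (length (M ∖ n) + length L′) ∎)
    where
    open ≡-Reasoning
    n-exposed : ¬ Covers M n
    n-exposed = proj₂ (proj₂ (All.lookup exposed n∈L))
  ... | no n∉L = +-mono-≤ (length-∖ M (IsMatching.disjoint matching))
                          (≤-reflexive (cong length (sym (filter-all (¬? ∘ (n ≟_)) (¬Any⇒All¬ L n∉L)))))

step4-bound : ∀ {G u ν} → EdgesBounded G → Vertex G u → colour G u ≡ red →
              MatchingBound G ν → MatchingBound (step4 G u) ν
step4-bound {G} {u} {ν} bounded u<n u-red bound {M} {L} matching distinct exposed
  with size G ∈? endpoints M
... | no n-exposed =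
  subst (λ M′ → length M′ + length L ≤ ν) (∖-uncovered M n-exposed)
        (bound (step4-restrict {G} {u} matching) distinct (All.map (step4-exposedRed {G} {u} {M}) exposed))
... | yes n-covered with find (covers⇒any M n-covered)
... | (a , b) , e∈ , n-e =
  subst (_≤ ν) shift
        (bound (step4-restrict {G} {u} matching) (u-new ∷ distinct)
               (u-exposed ∷ All.map (step4-exposedRed {G} {u} {M}) exposed))
  where
  disjoint : Disjoint M
  disjoint = IsMatching.disjoint matching
  u-e : Touches u (a , b)
  u-e = step4-new-edge {G} bounded (IsMatching.inGraph matching e∈) n-e
  u-exposed : ExposedRed G (M ∖ size G) u
  u-exposed = u<n , u-red , ∖-partner-exposed M disjoint e∈ n-e u-e
  u-new : All (u ≢_) L
  u-new = All.map (λ { (_ , _ , v-uncovered) refl → v-uncovered (any⇒covers M (lose e∈ u-e)) }) exposed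
  shift : length (M ∖ size G) + suc (length L) ≡ length M + length L
  shift = trans (+-suc _ _) (cong (_+ length L) (sym (length-∖-covered M disjoint n-covered)))

constructible-edgesBounded : ∀ {G} → Constructible G → EdgesBounded G
constructible-edgesBounded (cycle m) = oddCycle-edgesBounded m
constructible-edgesBounded (add3 c u u<n) (here refl)         = m<n⇒m<1+n (m<n⇒m<1+n u<n) , m<n⇒m<1+n (n<1+n _)
constructible-edgesBounded (add3 c u u<n) (there (here refl)) = m<n⇒m<1+n (n<1+n _) , n<1+n _
constructible-edgesBounded (add3 c u u<n) (there (there e))   =
  let a<n , b<n = constructible-edgesBounded c e
  in m<n⇒m<1+n (m<n⇒m<1+n a<n) , m<n⇒m<1+n (m<n⇒m<1+n b<n)
constructible-edgesBounded (add4 c u u<n _) (here refl) = m<n⇒m<1+n u<n , n<1+n _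
constructible-edgesBounded (add4 c u u<n _) (there e)   =
  let a<n , b<n = constructible-edgesBounded c e in m<n⇒m<1+n a<n , m<n⇒m<1+n b<n

canonicalMatching : ∀ {G} → Constructible G → List (ℕ × ℕ)
canonicalMatching (cycle m)        = pathMatching (suc m)
canonicalMatching (add3 {G} c _ _) = (size G , suc (size G)) ∷ canonicalMatching c
canonicalMatching (add4 c _ _ _)   = canonicalMatching c

canonicalMatching-isMatching : ∀ {G} (c : Constructible G) → IsMatching G (canonicalMatching c)
canonicalMatching-isMatching (cycle m) = record
  { inGraph  = inj₁ ∘ pathMatching-in-oddCycle m (suc m)
                       (subst (suc m + suc m ≤_) (sym (oddCycle-size m)) (n≤1+n _))
  ; disjoint = pathMatching-disjoint (suc m)
  }
canonicalMatching-isMatching (add3 c u _) = record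
  { inGraph  = λ { (here refl) → inj₁ (there (here refl))
                 ; (there e)   → [ inj₁ ∘ there ∘ there , inj₂ ∘ there ∘ there ]′ (IsMatching.inGraph old e) }
  ; disjoint = fresh-pair-unique (All.tabulate (covered⇒vertex (constructible-edgesBounded c) old))
                                 (IsMatching.disjoint old)
  }
  where
  old : IsMatching _ (canonicalMatching c)
  old = canonicalMatching-isMatching c
canonicalMatching-isMatching (add4 c u _ _) = record
  { inGraph  = [ inj₁ ∘ there , inj₂ ∘ there ]′ ∘ IsMatching.inGraph old
  ; disjoint = IsMatching.disjoint old
  }
  where
  old : IsMatching _ (canonicalMatching c)
  old = canonicalMatching-isMatching c

constructible-bound : ∀ {G} (c : Constructible G) → MatchingBound G (length (canonicalMatching c))
constructible-bound (cycle m)            =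
  subst (MatchingBound _) (sym (length-pathMatching (suc m))) (oddCycle-bound m)
constructible-bound (add3 c u _)         = step3-bound (constructible-bound c)
constructible-bound (add4 c u u<n u-red) =
  step4-bound (constructible-edgesBounded c) u<n u-red (constructible-bound c)

theorem4p4 : (G : CGraph) → Constructible G →
    (M : List (ℕ × ℕ)) → IsMaximumMatching G M →
    (v : ℕ) → v < size G → colour G v ≡ red → Covers M v
theorem4p4 G c M (matching , maximum) v v<n v-red with v ∈? endpoints M
... | yes covered = covered
... | no uncovered = contradiction (maximum _ (canonicalMatching-isMatching c)) (<⇒≱ M<ν)
  where
  M<ν : length M < length (canonicalMatching c)
  M<ν = subst (_≤ length (canonicalMatching c)) (+-comm (length M) 1)
              (constructible-bound c matching ([] ∷ []) ((v<n , v-red , uncovered) ∷ []))
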